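{- Work in CCSK$^{\mathrm{P}}$ as described in the context. For all proof keyed labels $\theta_1,\theta_2$: (i) if $\theta_1\,\iota\,\theta_2$ then $\theta_1\bowtie\theta_2$; (ii) if $\theta_1\otimes\theta_2$ then $\theta_1\bowtie\theta_2$; (iii) if $\theta_1\bowtie\theta_2$ then either $\theta_1\,\iota\,\theta_2$ or $\theta_1\otimes\theta_2$, but not both.
   Context: $\mathsf N$ is an infinite set of names with complement bijection $a\mapsto\overline a$; labels $\mathsf L=\mathsf N\cup\overline{\mathsf N}\cup\{\tau\}$ ranged over by $\alpha$, $\lambda$ ranges over $\mathsf L\setminus\{\tau\}$; $\mathsf K$ is a denumerable set of keys with decidable equality. Proof keyed labels: $\theta ::= v\,\alpha[k] \mid v\,\langle\theta_L,\theta_R\rangle$, where $v,v_1,v_2$ are finite strings over $\{|_L,|_R,+_L,+_R\}$ and $\theta_L=v_1\lambda[k]$, $\theta_R=v_2\overline\lambda[k]$ (same key). $s\theta$ denotes prefixing symbol $s$ to $\theta$, and $\alpha[k]$ denotes a label with empty string. $\mathrm{key}(v\alpha[k])=k$ and $\mathrm{key}(v\langle v_1\lambda[k],v_2\overline\lambda[k]\rangle)=k$. Let $D\in\{L,R\}$, $\overline L=R$, $\overline R=L$. Connectivity $\bowtie$ is the least relation closed under: (A$^1$) $\alpha[k]\bowtie\theta$; (A$^2$) $\theta\bowtie\alpha[k]$; (P$^1_D$) $\theta_1\bowtie\theta_2\Rightarrow|_D\theta_1\bowtie|_D\theta_2$; (P$^2_D$) $|_D\theta_1\bowtie|_{\overline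 D}\theta_2$; (C$^1_D$) $\theta_1\bowtie\theta_2\Rightarrow+_D\theta_1\bowtie+_D\theta_2$; (C$^2_D$) $+_D\theta_1\bowtie+_{\overline D}\theta_2$; (S$^1_D$) $\theta\bowtie\theta_D\Rightarrow|_D\theta\bowtie\langle\theta_L,\theta_R\rangle$; (S$^2_D$) $\theta_D\bowtie\theta\Rightarrow\langle\theta_L,\theta_R\rangle\bowtie|_D\theta$; (S$^3$) $\theta_1\bowtie\theta_1'$, $\theta_2\bowtie\theta_2'\Rightarrow\langle\theta_1,\theta_2\rangle\bowtie\langle\theta_1',\theta_2'\rangle$. Dependence $\otimes$ is the least relation closed under: (A$^1$) $\alpha[k]\otimes\theta$; (A$^2$) $\theta\otimes\alpha[k]$; (C$^1_D$) $\theta\otimes\theta'\Rightarrow+_D\theta\otimes+_D\theta'$; (C$^2_D$) $+_D\theta\otimes+_{\overline D}\theta'$; (P$^1_D$) $\theta\otimes\theta'\Rightarrow|_D\theta\otimes|_D\theta'$; (P$^2_D$) $\mathrm{key}(\theta)=\mathrm{key}(\theta')\Rightarrow|_D\theta\otimes|_{\overline D}\theta'$; (S$^1_D$) $\theta\otimes\theta_D\Rightarrow|_D\theta\otimes\langle\theta_L,\theta_R\rangle$; (S$^2_D$) $\theta_D\otimes\theta\Rightarrow\langle\theta_L,\theta_R\rangle\otimes|_D\theta$; (S$^3$) if $\{i,j\}=\{1,2\}$, $\theta_i\otimes\theta_i'$ and $\theta_j\bowtie\theta_j'$ then $\langle\theta_1,\theta_2\rangle\otimes\langle\theta_1',\theta_2'\rangle$.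 Independence $\iota$ is the least relation closed under (no action rules): (C$^1_D$) $\theta\,\iota\,\theta'\Rightarrow+_D\theta\,\iota\,+_D\theta'$; (P$^1_D$) $\theta\,\iota\,\theta'\Rightarrow|_D\theta\,\iota\,|_D\theta'$; (P$^2_D$) $\mathrm{key}(\theta)\neq\mathrm{key}(\theta')\Rightarrow|_D\theta\,\iota\,|_{\overline D}\theta'$; (S$^1_D$) $\theta\,\iota\,\theta_D\Rightarrow|_D\theta\,\iota\,\langle\theta_L,\theta_R\rangle$; (S$^2_D$) $\theta_D\,\iota\,\theta\Rightarrow\langle\theta_L,\theta_R\rangle\,\iota\,|_D\theta$; (S$^3$) $\theta_1\,\iota\,\theta_1'$, $\theta_2\,\iota\,\theta_2'\Rightarrow\langle\theta_1,\theta_2\rangle\,\iota\,\langle\theta_1',\theta_2'\rangle$. -}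

module Defs where

open import Data.List using (List; []; _∷_; foldr)
open import Relation.Binary.PropositionalEquality using (_≡_; _≢_)

data Dir : Set where
  L R : Dir

flipD : Dir → Dir
flipD L = R
flipD R = L

module CCSK (N K : Set) where

  data Vis : Set where
    nm : N → Vis
    co : N → Vis

  bar : Vis → Vis
  bar (nm a) = co a
  bar (co a) = nm a

  data Label : Set where
    vis : Vis → Label
    τ   : Label

  data Sym : Set where
    par : Dir → Sym
    ch  : Dir → Sym

  Str : Set
  Str = List Sym

  -- proof keyed labels
  --   act α k              represents  α[k]   (empty string)
  --   pre s θ              represents  s θ
  --   sync v₁ v₂ λ k       represents  ⟨ v₁ λ[k] , v₂ λ̄[k] ⟩
  data PKL : Set where
    act  : Label → K → PKL
    pre  : Sym → PKL → PKL
    sync : Str → Str → Vis → K → PKL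

  pfx : Str → PKL → PKL
  pfx v θ = foldr pre θ v

  compL compR : Str → Str → Vis → K → PKL
  compL v₁ v₂ l k = pfx v₁ (act (vis l) k)
  compR v₁ v₂ l k = pfx v₂ (act (vis (bar l)) k)

  comp : Dir → Str → Str → Vis → K → PKL
  comp L = compL
  comp R = compR

  key : PKL → K
  key (act α k)        = k
  key (pre s θ)        = key θ
  key (sync v₁ v₂ l k) = k

  data _⋈_ : PKL → PKL → Set where
    A¹ : ∀ {α k θ} → act α k ⋈ θ
    A² : ∀ {α k θ} → θ ⋈ act α k
    P¹ : ∀ D {θ₁ θ₂} → θ₁ ⋈ θ₂ → pre (par D) θ₁ ⋈ pre (par D) θ₂
    P² : ∀ D {θ₁ θ₂} → pre (par D) θ₁ ⋈ pre (par (flipD D)) θ₂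
    C¹ : ∀ D {θ₁ θ₂} → θ₁ ⋈ θ₂ → pre (ch D) θ₁ ⋈ pre (ch D) θ₂
    C² : ∀ D {θ₁ θ₂} → pre (ch D) θ₁ ⋈ pre (ch (flipD D)) θ₂
    S¹ : ∀ D {θ v₁ v₂ l k} → θ ⋈ comp D v₁ v₂ l k
         → pre (par D) θ ⋈ sync v₁ v₂ l k
    S² : ∀ D {θ v₁ v₂ l k} → comp D v₁ v₂ l k ⋈ θ
         → sync v₁ v₂ l k ⋈ pre (par D) θ
    S³ : ∀ {v₁ v₂ l k v₁' v₂' l' k'}
         → compL v₁ v₂ l k ⋈ compL v₁' v₂' l' k'
         → compR v₁ v₂ l k ⋈ compR v₁' v₂' l' k'
         → sync v₁ v₂ l k ⋈ sync v₁' v₂' l' k'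

  data _⊗_ : PKL → PKL → Set where
    A¹ : ∀ {α k θ} → act α k ⊗ θ
    A² : ∀ {α k θ} → θ ⊗ act α k
    C¹ : ∀ D {θ θ'} → θ ⊗ θ' → pre (ch D) θ ⊗ pre (ch D) θ'
    C² : ∀ D {θ θ'} → pre (ch D) θ ⊗ pre (ch (flipD D)) θ'
    P¹ : ∀ D {θ θ'} → θ ⊗ θ' → pre (par D) θ ⊗ pre (par D) θ'
    P² : ∀ D {θ θ'} → key θ ≡ key θ' → pre (par D) θ ⊗ pre (par (flipD D)) θ'
    S¹ : ∀ D {θ v₁ v₂ l k} → θ ⊗ comp D v₁ v₂ l k
         → pre (par D) θ ⊗ sync v₁ v₂ l k
    S² : ∀ D {θ v₁ v₂ l k} → comp D v₁ v₂ l k ⊗ θ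
         → sync v₁ v₂ l k ⊗ pre (par D) θ
    S³₁ : ∀ {v₁ v₂ l k v₁' v₂' l' k'}
         → compL v₁ v₂ l k ⊗ compL v₁' v₂' l' k'
         → compR v₁ v₂ l k ⋈ compR v₁' v₂' l' k'
         → sync v₁ v₂ l k ⊗ sync v₁' v₂' l' k'
    S³₂ : ∀ {v₁ v₂ l k v₁' v₂' l' k'}
         → compL v₁ v₂ l k ⋈ compL v₁' v₂' l' k'
         → compR v₁ v₂ l k ⊗ compR v₁' v₂' l' k'
         → sync v₁ v₂ l k ⊗ sync v₁' v₂' l' k'

  data _ι_ : PKL → PKL → Set where
    C¹ : ∀ D {θ θ'} → θ ι θ' → pre (ch D) θ ι pre (ch D) θ'
    P¹ : ∀ D {θ θ'} → θ ι θ' → pre (par D) θ ι pre (par D) θ'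
    P² : ∀ D {θ θ'} → key θ ≢ key θ' → pre (par D) θ ι pre (par (flipD D)) θ'
    S¹ : ∀ D {θ v₁ v₂ l k} → θ ι comp D v₁ v₂ l k
         → pre (par D) θ ι sync v₁ v₂ l k
    S² : ∀ D {θ v₁ v₂ l k} → comp D v₁ v₂ l k ι θ
         → sync v₁ v₂ l k ι pre (par D) θ
    S³ : ∀ {v₁ v₂ l k v₁' v₂' l' k'}
         → compL v₁ v₂ l k ι compL v₁' v₂' l' k'
         → compR v₁ v₂ l k ι compR v₁' v₂' l' k'
         → sync v₁ v₂ l k ι sync v₁' v₂' l' k'

-- Every ι-rule and ⊗-rule is a ⋈-rule of the same name with a side condition
-- added, and the side conditions are complementary: keys differ or agree at P²,
-- both premises independent or one dependent at S³, while the axioms and C² have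
-- no ι counterpart.  So a ⋈-derivation is sorted into exactly one of ι and ⊗ by
-- deciding the key equalities at its P² leaves.
module Submission where

open import Defs
open import Data.Product using (_×_; _,_; uncurry)
open import Data.Sum as Sum using (_⊎_; inj₁; inj₂)
open import Relation.Nullary using (¬_; yes; no)
open import Relation.Binary.Definitions using (DecidableEquality)

module Relations (N K : Set) where
  open CCSK N K

  ι⇒⋈ : ∀ {θ₁ θ₂} → θ₁ ι θ₂ → θ₁ ⋈ θ₂
  ι⇒⋈ (C¹ D p) = C¹ D (ι⇒⋈ p)
  ι⇒⋈ (P¹ D p) = P¹ D (ι⇒⋈ p)
  ι⇒⋈ (P² D _) = P² D
  ι⇒⋈ (S¹ D p) = S¹ D (ι⇒⋈ p)
  ι⇒⋈ (S² D p) = S² D (ι⇒⋈ p)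
  ι⇒⋈ (S³ p q) = S³ (ι⇒⋈ p) (ι⇒⋈ q)

  ⊗⇒⋈ : ∀ {θ₁ θ₂} → θ₁ ⊗ θ₂ → θ₁ ⋈ θ₂
  ⊗⇒⋈ A¹ = A¹
  ⊗⇒⋈ A² = A²
  ⊗⇒⋈ (C¹ D p) = C¹ D (⊗⇒⋈ p)
  ⊗⇒⋈ (C² D) = C² D
  ⊗⇒⋈ (P¹ D p) = P¹ D (⊗⇒⋈ p)
  ⊗⇒⋈ (P² D _) = P² D
  ⊗⇒⋈ (S¹ D p) = S¹ D (⊗⇒⋈ p)
  ⊗⇒⋈ (S² D p) = S² D (⊗⇒⋈ p)
  ⊗⇒⋈ (S³₁ p q) = S³ (⊗⇒⋈ p) q
  ⊗⇒⋈ (S³₂ p q) = S³ p (⊗⇒⋈ q)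

  -- Directions are split so that unification can rule out C² and P² against flipD.
  ι⇒¬⊗ : ∀ {θ₁ θ₂} → θ₁ ι θ₂ → ¬ θ₁ ⊗ θ₂
  ι⇒¬⊗ (C¹ L p) (C¹ .L q) = ι⇒¬⊗ p q
  ι⇒¬⊗ (C¹ R p) (C¹ .R q) = ι⇒¬⊗ p q
  ι⇒¬⊗ (P¹ L p) (P¹ .L q) = ι⇒¬⊗ p q
  ι⇒¬⊗ (P¹ R p) (P¹ .R q) = ι⇒¬⊗ p q
  ι⇒¬⊗ (P² L k≢k′) (P² .L k≡k′) = k≢k′ k≡k′
  ι⇒¬⊗ (P² R k≢k′) (P² .R k≡k′) = k≢k′ k≡k′
  ι⇒¬⊗ (S¹ D p) (S¹ .D q) = ι⇒¬⊗ p q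
  ι⇒¬⊗ (S² D p) (S² .D q) = ι⇒¬⊗ p q
  ι⇒¬⊗ (S³ p _) (S³₁ q _) = ι⇒¬⊗ p q
  ι⇒¬⊗ (S³ _ p) (S³₂ _ q) = ι⇒¬⊗ p q

  module _ (_≟_ : DecidableEquality K) where

    ⋈⇒ι⊎⊗ : ∀ {θ₁ θ₂} → θ₁ ⋈ θ₂ → θ₁ ι θ₂ ⊎ θ₁ ⊗ θ₂
    ⋈⇒ι⊎⊗ A¹ = inj₂ A¹
    ⋈⇒ι⊎⊗ A² = inj₂ A²
    ⋈⇒ι⊎⊗ (P¹ D p) = Sum.map (P¹ D) (P¹ D) (⋈⇒ι⊎⊗ p)
    ⋈⇒ι⊎⊗ (P² D {θ₁} {θ₂}) with key θ₁ ≟ key θ₂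
    ... | yes k≡k′ = inj₂ (P² D k≡k′)
    ... | no k≢k′ = inj₁ (P² D k≢k′)
    ⋈⇒ι⊎⊗ (C¹ D p) = Sum.map (C¹ D) (C¹ D) (⋈⇒ι⊎⊗ p)
    ⋈⇒ι⊎⊗ (C² D) = inj₂ (C² D)
    ⋈⇒ι⊎⊗ (S¹ D p) = Sum.map (S¹ D) (S¹ D) (⋈⇒ι⊎⊗ p)
    ⋈⇒ι⊎⊗ (S² D p) = Sum.map (S² D) (S² D) (⋈⇒ι⊎⊗ p)
    ⋈⇒ι⊎⊗ (S³ p q) with ⋈⇒ι⊎⊗ p | ⋈⇒ι⊎⊗ q
    ... | inj₂ p⊗ | _      = inj₂ (S³₁ p⊗ q)
    ... | inj₁ _  | inj₂ q⊗ = inj₂ (S³₂ p q⊗)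
    ... | inj₁ pι | inj₁ qι = inj₁ (S³ pι qι)

theorem2 : (N K : Set) → DecidableEquality K →
    let open CCSK N K in
    ((θ₁ θ₂ : PKL) → θ₁ ι θ₂ → θ₁ ⋈ θ₂) ×
    ((θ₁ θ₂ : PKL) → θ₁ ⊗ θ₂ → θ₁ ⋈ θ₂) ×
    ((θ₁ θ₂ : PKL) → θ₁ ⋈ θ₂ →
      (θ₁ ι θ₂ ⊎ θ₁ ⊗ θ₂) × ¬ (θ₁ ι θ₂ × θ₁ ⊗ θ₂))
theorem2 N K _≟_ =
    (λ _ _ → ι⇒⋈)
  , (λ _ _ → ⊗⇒⋈)
  , (λ _ _ θ₁⋈θ₂ → ⋈⇒ι⊎⊗ _≟_ θ₁⋈θ₂ , uncurry ι⇒¬⊗)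
  where open Relations N K
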